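{- Let $\alpha=(a_p)_p\in\mathcal{A}$. Let $S$ be an infinite set of primes and let $(b_p)_{p\in S}$ be a sequence of integers such that $b_p\to\infty$ as $p\to\infty$ in $S$, and $b_p=O(p^{\epsilon})$ as $p\to\infty$ for some $0<\epsilon<1$. Suppose that $a_p=b_p\bmod p$ for all $p\in S$. Assume further that there exists $\epsilon'$ with $\epsilon<\epsilon'<1$ such that $\#\{p\le X: p\in S\}\gg X^{\epsilon'}$ for all sufficiently large $X$. Then $\alpha\in\mathcal{A}\setminus\mathcal{C}_{\mathcal{A}}$.
   Context: $\mathcal{A}\coloneqq\bigl(\prod_{p}\mathbb{Z}/p\mathbb{Z}\bigr)/\bigl(\bigoplus_{p}\mathbb{Z}/p\mathbb{Z}\bigr)$, the product and sum over all primes $p$. An element of $\mathcal{A}$ is written $(a_p)_p$ with $a_p\in\mathbb{Z}/p\mathbb{Z}$; two elements are equal iff their components agree for all but finitely many primes. $\mathbb{Q}$ embeds diagonally in $\mathcal{A}$. $\mathcal{C}_{\mathcal{A}}$ denotes the integral closure of $\mathbb{Q}$ in $\mathcal{A}$; equivalently, $\alpha=(a_p)_p\in\mathcal{C}_{\mathcal{A}}$ iff there is a nonzero $f\in\mathbb{Z}[x]$ with $f(a_p)=0$ in $\mathbb{Z}/p\mathbb{Z}$ for all but finitely many primes $p$.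
   Formalization: The exponents $\epsilon$ and $\epsilon'$ are taken to be rational numbers with a common denominator. -}

module Defs where

open import Data.Nat using (ℕ; _≤_)
open import Data.Nat.Primality using (Prime)
open import Data.Integer using (ℤ; _+_; _*_; _-_; +_)
open import Data.Integer.Divisibility using (_∣_)
open import Data.List using (List; []; _∷_)
open import Data.List.Relation.Unary.Any using (Any)
open import Data.Product using (Σ; ∃; _×_)
open import Relation.Binary.PropositionalEquality using (_≢_)

-- An element α = (a_p)_p of ∏_p ℤ/pℤ is represented by a family of
-- integer representatives a : ℕ → ℤ (only prime indices p matter, and
-- a p is read modulo p).  Equality in 𝒜 (agreement mod p for all but
-- finitely many p) is never needed below: membership in 𝒞_𝒜 is
-- invariant under it.
Fam : Set
Fam = ℕ → ℤ

Poly : Set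
Poly = List ℤ

eval : Poly → ℤ → ℤ
eval []       x = + 0
eval (c ∷ cs) x = c + x * eval cs x

NonZeroPoly : Poly → Set
NonZeroPoly f = Any (λ c → c ≢ + 0) f

InCA : Fam → Set
InCA a = Σ Poly λ f → NonZeroPoly f × ∃ λ N → ∀ p → Prime p → N ≤ p →
           (+ p) ∣ eval f (a p)

{-# OPTIONS --safe #-}

-- Here ε = m/n and ε′ = m′/n.  Suppose f ≠ 0 had p ∣ f(a_p) for almost all p,
-- and let f have no zero beyond R.  Every large p ∈ S then divides f(b_p), where
-- R < b_p ≤ C X^(m/n) once p ≤ X.  For X = t^n the distinct primes of S in
-- [t^m, X] thus all divide the nonzero number ∏_{R < v ≤ R + C t^m} |f(v)|, which
-- is at most (t^m)^(O(C t^m)); so there are O(t^m) of them, and trivially at most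
-- t^m primes below t^m.  But S has ≫ X^(m′/n) = t^(m′) elements up to X and m < m′.
module Submission where

open import Defs
open import Data.Nat using (ℕ; _≤_; _<_; _^_; _*_)
open import Data.Nat.Primality using (Prime)
open import Data.Integer using (ℤ; +_; _-_; ∣_∣) renaming (_≤_ to _≤ℤ_)
open import Data.Integer.Divisibility using (_∣_)
open import Data.List using (List; length)
open import Data.List.Relation.Unary.All using (All)
open import Data.List.Relation.Unary.Unique.Propositional using (Unique)
open import Data.Product using (Σ; ∃; _×_)
open import Relation.Nullary using (¬_)

open import Data.Nat using (zero; suc; _+_; _∸_; NonZero; >-nonZero; z≤n; s≤s; z<s; _<?_; nonTrivial⇒≢1)
open import Data.Nat.Properties
open import Data.Nat.Divisibility using (divides; 1∣_; *-monoʳ-∣; ∣⇒≤)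
  renaming (_∣_ to _∣ℕ_; ∣-trans to ∣ℕ-trans)
open import Data.Nat.ListAction using (product)
open import Data.Nat.ListAction.Properties using (∈⇒∣product; product≢0)
open import Data.Nat.Primality using (prime⇒nonTrivial; prime⇒irreducible; euclidsLemma)
open import Data.Nat.Tactic.RingSolver using (solve-∀)
import Data.Integer as ℤ
import Data.Integer.Properties as ℤ
import Data.Integer.Divisibility.Signed as Signed
import Data.Integer.Tactic.RingSolver as ℤ-RingSolver
open import Data.List using ([]; _∷_; filter; applyUpTo)
open import Data.List.Properties using (length-applyUpTo)
open import Data.List.Extrema.Nat using (max; xs≤max)
open import Data.List.Membership.Propositional using (_∈_)
open import Data.List.Membership.Propositional.Properties using (∈-applyUpTo⁺)
open import Data.List.Relation.Unary.All using ([]; _∷_)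
import Data.List.Relation.Unary.All as All
import Data.List.Relation.Unary.All.Properties as All
open import Data.List.Relation.Unary.AllPairs using ([]; _∷_)
open import Data.List.Relation.Unary.Any using (here; there; any?)
import Data.List.Relation.Unary.Unique.Propositional.Properties as Unique
open import Data.Empty using (⊥)
open import Data.Product using (_,_; proj₁; proj₂)
open import Data.Sum using (inj₁; inj₂)
open import Data.Bool using (true; false)
open import Function using (_∘_)
open import Relation.Nullary using (yes; no; ¬?; does; contradiction)
open import Relation.Unary using (Pred; Decidable)
open import Relation.Unary.Properties using (∁?)
open import Relation.Binary.PropositionalEquality using (_≡_; _≢_; refl; sym; trans; cong; subst; ≢-sym)

^-distribʳ-* : ∀ m n o → (m * n) ^ o ≡ m ^ o * n ^ o
^-distribʳ-* m n zero    = refl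
^-distribʳ-* m n (suc o) =
  trans (cong (m * n *_) (^-distribʳ-* m n o)) ([m*n]*[o*p]≡[m*o]*[n*p] m n (m ^ o) (n ^ o))

[m^n]^o≡[m^o]^n : ∀ m n o → (m ^ n) ^ o ≡ (m ^ o) ^ n
[m^n]^o≡[m^o]^n m n o =
  trans (^-*-assoc m n o) (trans (cong (m ^_) (*-comm n o)) (sym (^-*-assoc m o n)))

m≤m^n : ∀ m n .{{_ : NonZero n}} → m ≤ m ^ n
m≤m^n zero    (suc n) = z≤n
m≤m^n (suc m) (suc n) = m≤m*n (suc m) (suc m ^ n) {{m^n≢0 (suc m) n}}

^-cancelˡ-≤ : ∀ n .{{_ : NonZero n}} {m o} → m ^ n ≤ o ^ n → m ≤ o
^-cancelˡ-≤ n m^n≤o^n = ≮⇒≥ (λ o<m → <⇒≱ (^-monoˡ-< n o<m) m^n≤o^n)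

^-cancelʳ-≤ : ∀ m → 1 < m → ∀ {n o} → m ^ n ≤ m ^ o → n ≤ o
^-cancelʳ-≤ m 1<m m^n≤m^o = ≮⇒≥ (λ o<n → <⇒≱ (^-monoʳ-< m 1<m o<n) m^n≤m^o)

m+n*o≤[m+n]*o : ∀ m n o .{{_ : NonZero o}} → m + n * o ≤ (m + n) * o
m+n*o≤[m+n]*o m n o =
  ≤-trans (+-monoˡ-≤ (n * o) (m≤m*n m o)) (≤-reflexive (sym (*-distribʳ-+ o m n)))

v≤C*t^m : ∀ {v p t m n C} .{{_ : NonZero n}} → v ^ n ≤ C * p ^ m → p ≤ t ^ n → v ≤ C * t ^ m
v≤C*t^m {v} {p} {t} {m} {n} {C} v^n≤C*p^m p≤t^n = ^-cancelˡ-≤ n (begin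
  v ^ n                ≤⟨ v^n≤C*p^m ⟩
  C * p ^ m            ≤⟨ *-mono-≤ (m≤m^n C n) (^-monoˡ-≤ m p≤t^n) ⟩
  C ^ n * (t ^ n) ^ m  ≡⟨ cong (C ^ n *_) ([m^n]^o≡[m^o]^n t n m) ⟩
  C ^ n * (t ^ m) ^ n  ≡⟨ sym (^-distribʳ-* C (t ^ m) n) ⟩
  (C * t ^ m) ^ n      ∎)
  where open ≤-Reasoning

[t^n]^m′≤[D*t^m]^n⇒t≤D : ∀ {t D m m′ n} .{{_ : NonZero t}} .{{_ : NonZero n}} →
                         m < m′ → (t ^ n) ^ m′ ≤ (D * t ^ m) ^ n → t ≤ D
[t^n]^m′≤[D*t^m]^n⇒t≤D {t} {D} {m} {m′} {n} m<m′ growth =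
  *-cancelʳ-≤ t D (t ^ m) {{m^n≢0 t m}} (^-cancelˡ-≤ n (begin
    (t * t ^ m) ^ n  ≡⟨ [m^n]^o≡[m^o]^n t (suc m) n ⟩
    (t ^ n) ^ suc m  ≤⟨ ^-monoʳ-≤ (t ^ n) {{m^n≢0 t n}} m<m′ ⟩
    (t ^ n) ^ m′     ≤⟨ growth ⟩
    (D * t ^ m) ^ n  ∎))
  where open ≤-Reasoning

^length≤product : ∀ {m ns} → All (m ≤_) ns → m ^ length ns ≤ product ns
^length≤product []            = ≤-refl
^length≤product (m≤n ∷ m≤ns) = *-mono-≤ m≤n (^length≤product m≤ns)

product≤^length : ∀ {m ns} → All (_≤ m) ns → product ns ≤ m ^ length ns
product≤^length []            = ≤-refl
product≤^length (n≤m ∷ ns≤m) = *-mono-≤ n≤m (product≤^length ns≤m)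

module _ {a p} {A : Set a} {P : Pred A p} (P? : Decidable P) where

  length-filter+length-filter-∁ : ∀ xs →
    length (filter P? xs) + length (filter (∁? P?) xs) ≡ length xs
  length-filter+length-filter-∁ []       = refl
  length-filter+length-filter-∁ (x ∷ xs) with does (P? x)
  ... | true  = cong suc (length-filter+length-filter-∁ xs)
  ... | false = trans (+-suc _ _) (cong suc (length-filter+length-filter-∁ xs))

unique-constant⇒length≤1 : ∀ {a} {A : Set a} {y : A} {xs} → Unique xs → All (_≡ y) xs → length xs ≤ 1
unique-constant⇒length≤1 []                []                = z≤n
unique-constant⇒length≤1 (_ ∷ [])          (_ ∷ [])          = ≤-refl
unique-constant⇒length≤1 ((x≢x′ ∷ _) ∷ _) (refl ∷ refl ∷ _) = contradiction refl x≢x′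

unique-below⇒length≤ : ∀ {n xs} → Unique xs → All (_< n) xs → length xs ≤ n
unique-below⇒length≤ {zero}  {[]}    _         _        = z≤n
unique-below⇒length≤ {zero}  {_ ∷ _} _         (() ∷ _)
unique-below⇒length≤ {suc n} {xs}    xs-unique xs<1+n = begin
  length xs                                                   ≡⟨ sym (length-filter+length-filter-∁ (_<? n) xs) ⟩
  length (filter (_<? n) xs) + length (filter (∁? (_<? n)) xs) ≤⟨ +-mono-≤ below-n equal-n ⟩
  n + 1                                                       ≡⟨ +-comm n 1 ⟩
  suc n                                                       ∎
  where
  open ≤-Reasoning
  below-n : length (filter (_<? n) xs) ≤ n
  below-n = unique-below⇒length≤ (Unique.filter⁺ (_<? n) xs-unique) (All.all-filter (_<? n) xs)
  equal-n : length (filter (∁? (_<? n)) xs) ≤ 1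
  equal-n = unique-constant⇒length≤1 (Unique.filter⁺ (∁? (_<? n)) xs-unique)
    (All.zipWith (λ (x<1+n , x≮n) → ≤-antisym (≤-pred x<1+n) (≮⇒≥ x≮n))
                 (All.filter⁺ (∁? (_<? n)) xs<1+n , All.all-filter (∁? (_<? n)) xs))

prime∣prime⇒≡ : ∀ {p q} → Prime p → Prime q → p ∣ℕ q → p ≡ q
prime∣prime⇒≡ p-prime q-prime p∣q with prime⇒irreducible q-prime p∣q
... | inj₁ p≡1 = contradiction p≡1 (nonTrivial⇒≢1 {{prime⇒nonTrivial p-prime}})
... | inj₂ p≡q = p≡q

prime∣m*p⇒∣m : ∀ {m p q} → Prime p → Prime q → q ≢ p → q ∣ℕ m * p → q ∣ℕ m
prime∣m*p⇒∣m {m} {p} p-prime q-prime q≢p q∣m*p with euclidsLemma m p q-prime q∣m*p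
... | inj₁ q∣m = q∣m
... | inj₂ q∣p = contradiction (prime∣prime⇒≡ q-prime p-prime q∣p) q≢p

product-distinct-primes-∣ : ∀ {n ps} → Unique ps → All Prime ps → All (_∣ℕ n) ps → product ps ∣ℕ n
product-distinct-primes-∣                 []                  []                  []                      = 1∣ _
product-distinct-primes-∣ {ps = p ∷ ps} (p∉ps ∷ ps-unique) (p-prime ∷ ps-prime) (divides q refl ∷ ps∣q*p) =
  subst (p * product ps ∣ℕ_) (*-comm p q) (*-monoʳ-∣ p (product-distinct-primes-∣ ps-unique ps-prime ps∣q))
  where
  ps∣q : All (_∣ℕ q) ps
  ps∣q = All.zipWith (λ ((p≢r , r-prime) , r∣q*p) → prime∣m*p⇒∣m p-prime r-prime (≢-sym p≢r) r∣q*p)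
                     (All.zip (p∉ps , ps-prime) , ps∣q*p)

distinct-large-prime-divisors-length≤ : ∀ {Y e n ps} .{{_ : NonZero n}} → 1 < Y → n ≤ Y ^ e →
  Unique ps → All Prime ps → All (Y ≤_) ps → All (_∣ℕ n) ps → length ps ≤ e
distinct-large-prime-divisors-length≤ {Y} {e} {n} {ps} 1<Y n≤Y^e ps-unique ps-prime Y≤ps ps∣n =
  ^-cancelʳ-≤ Y 1<Y (begin
    Y ^ length ps  ≤⟨ ^length≤product Y≤ps ⟩
    product ps     ≤⟨ ∣⇒≤ (product-distinct-primes-∣ ps-unique ps-prime ps∣n) ⟩
    n              ≤⟨ n≤Y^e ⟩
    Y ^ e          ∎)
  where open ≤-Reasoning

‖_‖₁ : Poly → ℕ
‖ []     ‖₁ = 0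
‖ c ∷ cs ‖₁ = ∣ c ∣ + ‖ cs ‖₁

sub∣eval-sub : ∀ f x y → (x - y) Signed.∣ (eval f x - eval f y)
sub∣eval-sub []       x y = Signed.divides (+ 0) refl
sub∣eval-sub (c ∷ cs) x y = subst ((x - y) Signed.∣_) (sym (expand c x y (eval cs x) (eval cs y)))
  (Signed.∣m∣n⇒∣m+n (Signed.∣n⇒∣m*n x (sub∣eval-sub cs x y))
                    (Signed.∣m⇒∣m*n (eval cs y) Signed.∣-refl))
  where
  expand : ∀ c x y fx fy → (c ℤ.+ x ℤ.* fx) - (c ℤ.+ y ℤ.* fy) ≡ x ℤ.* (fx - fy) ℤ.+ (x - y) ℤ.* fy
  expand = ℤ-RingSolver.solve-∀

eval-respects-∣-sub : ∀ f {k x y} → k ∣ (x - y) → k ∣ eval f x → k ∣ eval f y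
eval-respects-∣-sub f {k} {x} {y} k∣x-y k∣fx =
  Signed.∣⇒∣ᵤ (subst (k Signed.∣_) (cancel (eval f x) (eval f y)) k∣fx-[fx-fy])
  where
  k∣fx-[fx-fy] : k Signed.∣ eval f x - (eval f x - eval f y)
  k∣fx-[fx-fy] = Signed.∣m∣n⇒∣m-n (Signed.∣ᵤ⇒∣ {i = eval f x} k∣fx)
    (Signed.∣-trans (Signed.∣ᵤ⇒∣ k∣x-y) (sub∣eval-sub f x y))
  cancel : ∀ fx fy → fx - (fx - fy) ≡ fy
  cancel = ℤ-RingSolver.solve-∀

∣eval∣≤‖f‖₁*v^length : ∀ f v .{{_ : NonZero v}} → ∣ eval f (+ v) ∣ ≤ ‖ f ‖₁ * v ^ length f
∣eval∣≤‖f‖₁*v^length []       v = z≤n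
∣eval∣≤‖f‖₁*v^length (c ∷ cs) v = begin
  ∣ c ℤ.+ + v ℤ.* eval cs (+ v) ∣              ≤⟨ ℤ.∣i+j∣≤∣i∣+∣j∣ c _ ⟩
  ∣ c ∣ + ∣ + v ℤ.* eval cs (+ v) ∣            ≡⟨ cong (λ x → ∣ c ∣ + x) (ℤ.abs-* (+ v) _) ⟩
  ∣ c ∣ + v * ∣ eval cs (+ v) ∣                ≤⟨ +-mono-≤ (m≤m*n ∣ c ∣ (v ^ suc d) {{m^n≢0 v (suc d)}})
                                                             (*-monoʳ-≤ v (∣eval∣≤‖f‖₁*v^length cs v)) ⟩
  ∣ c ∣ * (v * v ^ d) + v * (‖ cs ‖₁ * v ^ d)  ≡⟨ regroup ∣ c ∣ v ‖ cs ‖₁ (v ^ d) ⟩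
  (∣ c ∣ + ‖ cs ‖₁) * (v * v ^ d)              ∎
  where
  open ≤-Reasoning
  d : ℕ
  d = length cs
  regroup : ∀ a v k w → a * (v * w) + v * (k * w) ≡ (a + k) * (v * w)
  regroup = solve-∀

eval-≡0 : ∀ f → ¬ NonZeroPoly f → ∀ x → eval f x ≡ + 0
eval-≡0 []       _   x = refl
eval-≡0 (c ∷ cs) f≡0 x with c ℤ.≟ + 0
... | no c≢0 = contradiction (here c≢0) f≡0
... | yes refl rewrite eval-≡0 cs (f≡0 ∘ there) x | ℤ.*-zeroʳ x = refl

eval-eventually-≢0 : ∀ f → NonZeroPoly f → ∃ λ R → ∀ v → R < v → ℤ.NonZero (eval f (+ v))
eval-eventually-≢0 (c ∷ cs) f≢0 with any? (λ c → ¬? (c ℤ.≟ + 0)) cs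
... | no cs≡0 = 0 , λ v _ → subst ℤ.NonZero (sym (constant v)) (ℤ.≢-nonZero (head≢0 f≢0))
  where
  head≢0 : NonZeroPoly (c ∷ cs) → c ≢ + 0
  head≢0 (here c≢0)   = c≢0
  head≢0 (there cs≢0) = contradiction cs≢0 cs≡0
  constant : ∀ v → eval (c ∷ cs) (+ v) ≡ c
  constant v rewrite eval-≡0 cs cs≡0 (+ v) | ℤ.*-zeroʳ (+ v) = ℤ.+-identityʳ c
... | yes cs≢0 with R , cs[v]≢0 ← eval-eventually-≢0 cs cs≢0 =
  R + ∣ c ∣ , λ v R+∣c∣<v → >-nonZero (≤-<-trans z≤n (R<∣f[v]∣ v R+∣c∣<v))
  where
  R<∣f[v]∣ : ∀ v → R + ∣ c ∣ < v → R < ∣ eval (c ∷ cs) (+ v) ∣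
  R<∣f[v]∣ v R+∣c∣<v = +-cancelʳ-< ∣ c ∣ R _ (<-≤-trans R+∣c∣<v (begin
    v                                ≤⟨ m≤m*n v ∣ eval cs (+ v) ∣ {{cs[v]≢0 v R<v}} ⟩
    v * ∣ eval cs (+ v) ∣            ≡⟨ sym (ℤ.abs-* (+ v) (eval cs (+ v))) ⟩
    ∣ + v ℤ.* eval cs (+ v) ∣        ≡⟨ cong ∣_∣ (sym (cancel c (+ v ℤ.* eval cs (+ v)))) ⟩
    ∣ eval (c ∷ cs) (+ v) - c ∣      ≤⟨ ℤ.∣i-j∣≤∣i∣+∣j∣ (eval (c ∷ cs) (+ v)) c ⟩
    ∣ eval (c ∷ cs) (+ v) ∣ + ∣ c ∣  ∎))
    where
    open ≤-Reasoning
    R<v : R < v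
    R<v = ≤-<-trans (m≤m+n R ∣ c ∣) R+∣c∣<v
    cancel : ∀ c w → (c ℤ.+ w) - c ≡ w
    cancel = ℤ-RingSolver.solve-∀

module _ (f : Poly) (R : ℕ) where

  values : ℕ → List ℕ
  values J = applyUpTo (λ j → ∣ eval f (+ suc (R + j)) ∣) J

  DividesSomeValue : ℕ → ℕ → Set
  DividesSomeValue J p = ∃ λ v → R < v × v ≤ R + J × p ∣ℕ ∣ eval f (+ v) ∣

  ∈-values : ∀ {J v} → R < v → v ≤ R + J → ∣ eval f (+ v) ∣ ∈ values J
  ∈-values {J} {v} R<v v≤R+J = subst (λ w → ∣ eval f (+ w) ∣ ∈ values J) 1+R+j≡v
    (∈-applyUpTo⁺ _ (+-cancelˡ-< R _ J (subst (_≤ R + J) (sym 1+R+j≡v) v≤R+J)))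
    where
    1+R+j≡v : suc R + (v ∸ suc R) ≡ v
    1+R+j≡v = m+[n∸m]≡n R<v

  product-values≤ : ∀ {Y J} → ‖ f ‖₁ ≤ Y → R + J ≤ Y * Y →
                    product (values J) ≤ Y ^ (suc (length f + length f) * J)
  product-values≤ {Y} {J} ‖f‖₁≤Y R+J≤Y*Y = begin
    product (values J)                 ≤⟨ product≤^length (All.applyUpTo⁺₁ _ J value≤) ⟩
    (Y ^ e) ^ length (values J)        ≡⟨ cong ((Y ^ e) ^_) (length-applyUpTo _ J) ⟩
    (Y ^ e) ^ J                        ≡⟨ ^-*-assoc Y e J ⟩
    Y ^ (e * J)                        ∎
    where
    open ≤-Reasoning
    d e : ℕ
    d = length f
    e = suc (d + d)
    value≤ : ∀ {j} → j < J → ∣ eval f (+ suc (R + j)) ∣ ≤ Y ^ e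
    value≤ {j} j<J = begin
      ∣ eval f (+ suc (R + j)) ∣       ≤⟨ ∣eval∣≤‖f‖₁*v^length f (suc (R + j)) ⟩
      ‖ f ‖₁ * suc (R + j) ^ d         ≤⟨ *-mono-≤ ‖f‖₁≤Y (^-monoˡ-≤ d (≤-trans (+-monoʳ-< R j<J) R+J≤Y*Y)) ⟩
      Y * (Y * Y) ^ d                  ≡⟨ cong (Y *_) (trans (^-distribʳ-* Y Y d) (sym (^-distribˡ-+-* Y d d))) ⟩
      Y ^ e                            ∎

  module _ (f≢0 : ∀ v → R < v → ℤ.NonZero (eval f (+ v))) where

    values≢0 : ∀ J → All NonZero (values J)
    values≢0 J = All.applyUpTo⁺₂ _ J (λ j → f≢0 (suc (R + j)) (s≤s (m≤m+n R j)))

    large-prime-divisors-of-values-length≤ : ∀ {Y J ps} → 1 < Y → ‖ f ‖₁ ≤ Y → R + J ≤ Y * Y →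
      Unique ps → All Prime ps → All (Y ≤_) ps → All (DividesSomeValue J) ps →
      length ps ≤ suc (length f + length f) * J
    large-prime-divisors-of-values-length≤ {Y} {J} 1<Y ‖f‖₁≤Y R+J≤Y*Y ps-unique ps-prime Y≤ps ps∣values =
      distinct-large-prime-divisors-length≤ {{product≢0 (values≢0 J)}} 1<Y
        (product-values≤ ‖f‖₁≤Y R+J≤Y*Y) ps-unique ps-prime Y≤ps
        (All.map (λ (v , R<v , v≤R+J , p∣f[v]) → ∣ℕ-trans p∣f[v] (∈⇒∣product (∈-values R<v v≤R+J)))
                 ps∣values)

    length≤Y+O[J] : ∀ {Y J ps} → 1 < Y → ‖ f ‖₁ ≤ Y → R + J ≤ Y * Y → Unique ps →
      All (λ p → Y ≤ p → Prime p × DividesSomeValue J p) ps →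
      length ps ≤ Y + suc (length f + length f) * J
    length≤Y+O[J] {Y} {J} {ps} 1<Y ‖f‖₁≤Y R+J≤Y*Y ps-unique ps-large = begin
      length ps                                                   ≡⟨ sym (length-filter+length-filter-∁ (_<? Y) ps) ⟩
      length (filter (_<? Y) ps) + length (filter (∁? (_<? Y)) ps) ≤⟨ +-mono-≤ small large ⟩
      Y + suc (length f + length f) * J                           ∎
      where
      open ≤-Reasoning
      small : length (filter (_<? Y) ps) ≤ Y
      small = unique-below⇒length≤ (Unique.filter⁺ (_<? Y) ps-unique) (All.all-filter (_<? Y) ps)
      Y≤large : All (Y ≤_) (filter (∁? (_<? Y)) ps)
      Y≤large = All.map ≮⇒≥ (All.all-filter (∁? (_<? Y)) ps)
      large-good : All (λ p → Prime p × DividesSomeValue J p) (filter (∁? (_<? Y)) ps)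
      large-good = All.zipWith (λ (good , Y≤p) → good Y≤p) (All.filter⁺ (∁? (_<? Y)) ps-large , Y≤large)
      large : length (filter (∁? (_<? Y)) ps) ≤ suc (length f + length f) * J
      large = large-prime-divisors-of-values-length≤ 1<Y ‖f‖₁≤Y R+J≤Y*Y (Unique.filter⁺ (∁? (_<? Y)) ps-unique)
        (All.map proj₁ large-good) Y≤large (All.map proj₂ large-good)

    length≤O[t^m] : ∀ {t m C ps} .{{_ : NonZero m}} → 1 < t → ‖ f ‖₁ ≤ t → R + C ≤ t → Unique ps →
      All (λ p → t ^ m ≤ p → Prime p × DividesSomeValue (C * t ^ m) p) ps →
      length ps ≤ (1 + suc (length f + length f) * C) * t ^ m
    length≤O[t^m] {t} {m} {C} {ps} 1<t ‖f‖₁≤t R+C≤t ps-unique ps-large = begin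
      length ps                                 ≤⟨ length≤Y+O[J] 1<Y ‖f‖₁≤Y R+J≤Y*Y ps-unique ps-large ⟩
      Y + suc (length f + length f) * (C * Y)   ≡⟨ regroup Y (suc (length f + length f)) C ⟩
      (1 + suc (length f + length f) * C) * Y   ∎
      where
      open ≤-Reasoning
      Y : ℕ
      Y = t ^ m
      t≤Y : t ≤ Y
      t≤Y = m≤m^n t m
      1<Y : 1 < Y
      1<Y = <-≤-trans 1<t t≤Y
      ‖f‖₁≤Y : ‖ f ‖₁ ≤ Y
      ‖f‖₁≤Y = ≤-trans ‖f‖₁≤t t≤Y
      R+J≤Y*Y : R + C * Y ≤ Y * Y
      R+J≤Y*Y = ≤-trans (m+n*o≤[m+n]*o R C Y {{m^n≢0 t m {{>-nonZero (<-trans z<s 1<t)}}}})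
                        (*-monoˡ-≤ Y (≤-trans R+C≤t t≤Y))
      regroup : ∀ Y e C → Y + e * (C * Y) ≡ (1 + e * C) * Y
      regroup = solve-∀

lemma2p5 : (a : Fam) (S : ℕ → Set) (b : ℕ → ℤ)
    → (∀ p → S p → Prime p)
    → (∀ N → ∃ λ p → N ≤ p × S p)
    → (∀ (M : ℤ) → ∃ λ N → ∀ p → S p → N ≤ p → M ≤ℤ b p)
    → (m m′ n : ℕ) → 0 < m → m < m′ → m′ < n
    → (∃ λ C → ∃ λ N → ∀ p → S p → N ≤ p → ∣ b p ∣ ^ n ≤ C * p ^ m)
    → (∀ p → S p → (+ p) ∣ (a p - b p))
    → (∃ λ k → ∃ λ X₀ → ∀ X → X₀ ≤ X →
    Σ (List ℕ) λ ps → Unique ps × All (λ p → S p × p ≤ X) ps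
    × X ^ m′ ≤ (k * length ps) ^ n)
    → ¬ InCA a
-- The infinitude of S is implied by the density hypothesis.
lemma2p5 a S b S-prime _ b→∞ m m′ n 0<m m<m′ m′<n (C , N_C , b-bound) a≡b (k , X₀ , dense)
         (f , f≢0 , N_f , f[a]≡0)
  with R , f[v]≢0 ← eval-eventually-≢0 f f≢0
  with N_b , R<b ← b→∞ (+ suc R)
  = contradiction-at (max 0 thresholds) (xs≤max 0 thresholds)
  where
  e D : ℕ
  e = suc (length f + length f)
  D = k * (1 + e * C)
  thresholds : List ℕ
  thresholds = 2 ∷ suc D ∷ N_f ∷ N_b ∷ N_C ∷ X₀ ∷ R + C ∷ ‖ f ‖₁ ∷ []
  instance
    m≢0 : NonZero m
    m≢0 = >-nonZero 0<m
    n≢0 : NonZero n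
    n≢0 = >-nonZero (<-trans 0<m (<-trans m<m′ m′<n))

  contradiction-at : ∀ t → All (_≤ t) thresholds → ⊥
  contradiction-at t (2≤t ∷ D<t ∷ N_f≤t ∷ N_b≤t ∷ N_C≤t ∷ X₀≤t ∷ R+C≤t ∷ ‖f‖₁≤t ∷ [])
    with ps , ps-unique , ps⊆S , growth ← dense (t ^ n) (≤-trans X₀≤t (m≤m^n t n))
    = <⇒≱ D<t ([t^n]^m′≤[D*t^m]^n⇒t≤D {{>-nonZero (<-trans z<s 2≤t)}} m<m′ (begin
      (t ^ n) ^ m′                      ≤⟨ growth ⟩
      (k * length ps) ^ n               ≤⟨ ^-monoˡ-≤ n (*-monoʳ-≤ k length-ps≤) ⟩
      (k * ((1 + e * C) * t ^ m)) ^ n   ≡⟨ cong (_^ n) (sym (*-assoc k (1 + e * C) (t ^ m))) ⟩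
      (D * t ^ m) ^ n                   ∎))
    where
    open ≤-Reasoning
    beyond : ∀ {c p} → c ≤ t → t ^ m ≤ p → c ≤ p
    beyond c≤t t^m≤p = ≤-trans c≤t (≤-trans (m≤m^n t m) t^m≤p)
    large-prime-divides-value : ∀ {p} → S p × p ≤ t ^ n → t ^ m ≤ p →
                                Prime p × DividesSomeValue f R (C * t ^ m) p
    large-prime-divides-value {p} (p∈S , p≤t^n) t^m≤p
      with b p | R<b p p∈S (beyond N_b≤t t^m≤p) | b-bound p p∈S (beyond N_C≤t t^m≤p)
         | eval-respects-∣-sub f {+ p} (a≡b p p∈S) (f[a]≡0 p (S-prime p p∈S) (beyond N_f≤t t^m≤p))
    ... | + v | ℤ.+≤+ R<v | v^n≤C*p^m | p∣f[v] =
      S-prime p p∈S , v , R<v , ≤-trans (v≤C*t^m {m = m} {C = C} v^n≤C*p^m p≤t^n) (m≤n+m _ R) , p∣f[v]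
    length-ps≤ : length ps ≤ (1 + e * C) * t ^ m
    length-ps≤ = length≤O[t^m] f R f[v]≢0 2≤t ‖f‖₁≤t R+C≤t ps-unique
                   (All.map large-prime-divides-value ps⊆S)
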